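{- Let $T$ be a Latin square of order $n\ge 3$. Then the isotopy graph $\mathscr{G}(T)$ is regular of degree $3\binom{n}{2}$.
   Context: A Latin square of order $n$ is an $n\times n$ array filled with $1,\dots,n$ so that each row and each column contains every one of $1,\dots,n$ exactly once. Elementary transformations: interchanging two rows, interchanging two columns, or interchanging two symbols $x,y$ everywhere. The isotopy graph $\mathscr{G}(T)$ has as vertices all Latin squares obtainable from $T$ by finite sequences of elementary transformations; two distinct vertices are joined by a single edge if one is obtained from the other by a single elementary transformation. -}

module Defs where

open import Data.Nat using (ℕ)
open import Data.Fin using (Fin)
open import Data.Fin.Properties using (_≟_)
open import Data.Product using (Σ; _×_; ∃)
open import Data.List using (List; length)
open import Data.List.Relation.Unary.All using (All)
open import Data.List.Relation.Unary.Any using (Any)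
open import Data.List.Relation.Unary.AllPairs using (AllPairs)
open import Relation.Nullary using (¬_; yes; no)
open import Relation.Binary.PropositionalEquality using (_≡_)

-- An n×n array with entries in {1..n} (encoded as Fin n): L row column.
Square : ℕ → Set
Square n = Fin n → Fin n → Fin n

_≈_ : ∀ {n} → Square n → Square n → Set
A ≈ B = ∀ i j → A i j ≡ B i j

IsLatin : ∀ {n} → Square n → Set
IsLatin {n} L =
  (∀ (i s : Fin n) → Σ (Fin n) λ j → L i j ≡ s × (∀ j′ → L i j′ ≡ s → j′ ≡ j)) ×
  (∀ (j s : Fin n) → Σ (Fin n) λ i → L i j ≡ s × (∀ i′ → L i′ j ≡ s → i′ ≡ i))

swap : ∀ {n} → Fin n → Fin n → Fin n → Fin n
swap x y z with z ≟ x
... | yes _ = y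
... | no _ with z ≟ y
...   | yes _ = x
...   | no _ = z

data Elementary (n : ℕ) : Set where
  rowSwap colSwap symSwap : Fin n → Fin n → Elementary n

apply : ∀ {n} → Elementary n → Square n → Square n
apply (rowSwap x y) L i j = L (swap x y i) j
apply (colSwap x y) L i j = L i (swap x y j)
apply (symSwap x y) L i j = swap x y (L i j)

OneStep : ∀ {n} → Square n → Square n → Set
OneStep {n} A B = Σ (Elementary n) λ e → apply e A ≈ B

-- Vertices of the isotopy graph 𝒢(T): squares obtainable from T by a finite
-- sequence of elementary transformations.
data Vertex {n : ℕ} (T : Square n) : Square n → Set where
  here : ∀ {L} → T ≈ L → Vertex T L
  step : ∀ {L L′} → Vertex T L → OneStep L L′ → Vertex T L′

Adjacent : ∀ {n} → Square n → Square n → Set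
Adjacent A B = ¬ (A ≈ B) × OneStep A B

-- L has exactly d neighbours (in 𝒢(T)): there is a duplicate-free list of
-- length d containing precisely the squares adjacent to L (up to ≈).
HasDegree : ∀ {n} → Square n → ℕ → Set
HasDegree {n} L d =
  Σ (List (Square n)) λ ns →
    length ns ≡ d ×
    AllPairs (λ A B → ¬ (A ≈ B)) ns ×
    All (Adjacent L) ns ×
    (∀ L′ → Adjacent L L′ → Any (λ A → A ≈ L′) ns)

IsotopyGraphRegular : ∀ {n} → Square n → ℕ → Set
IsotopyGraphRegular T d = ∀ L → Vertex T L → HasDegree L d

module Submission where

-- Every vertex L of 𝒢(T) is again a Latin square, since elementary
-- transformations preserve the Latin property.  Call an elementary
-- transformation proper if the two rows/columns/symbols x, y it interchanges
-- satisfy x < y; there are exactly 3·C(n,2) of them.  For a Latin square L: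
--   * a proper transformation moves L (the interchanged lines differ);
--   * distinct proper transformations give distinct squares (this is where
--     n ≥ 3 is needed: a third line or symbol separates the three kinds);
--   * every transformation that moves L agrees on L with a proper one.
-- Hence the images of L under the proper transformations are exactly its
-- neighbours, listed without repetition.

open import Defs
open import Data.Nat using (ℕ; zero; suc; _≤_; _*_; _+_; s≤s; z≤n)
open import Data.Nat.Combinatorics using (_C_; nC1≡n; nCk+nC[k+1]≡[n+1]C[k+1])
open import Data.Fin using (Fin; zero; suc; _<_)
open import Data.Fin.Properties using (_≟_; <-cmp; <⇒≢; <-asym; suc-injective)
open import Data.Product using (∃; _×_; _,_; proj₁; proj₂)
open import Data.Empty using (⊥-elim)
open import Data.List using (List; []; _∷_; _++_; map; length; allFin; cartesianProductWith)
open import Data.List.Properties using (length-++; length-map; length-tabulate)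
open import Data.List.Relation.Unary.All as All using (All; []; _∷_)
import Data.List.Relation.Unary.All.Properties as All
open import Data.List.Relation.Unary.Any as Any using (Any; here; there)
import Data.List.Relation.Unary.Any.Properties as Any
open import Data.List.Relation.Unary.AllPairs using (AllPairs; []; _∷_)
open import Data.List.Relation.Unary.Unique.Propositional using (Unique)
import Data.List.Relation.Unary.Unique.Propositional.Properties as Unique
open import Data.List.Relation.Binary.Disjoint.Propositional using (Disjoint)
open import Data.List.Membership.Propositional using (_∈_)
open import Data.List.Membership.Propositional.Properties using (∈-map⁺; ∈-map⁻; ∈-++⁺ˡ; ∈-++⁺ʳ; ∈-allFin)
open import Relation.Nullary using (¬_; yes; no)
open import Relation.Binary.Definitions using (DecidableEquality; tri<; tri≈; tri>)
open import Relation.Binary.PropositionalEquality using (_≡_; _≢_; refl; sym; trans; cong; cong₂; subst; setoid; module ≡-Reasoning)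

-- Transpositions

data SwapView {n : ℕ} (x y z : Fin n) : Fin n → Set where
  at-x      : z ≡ x →         SwapView x y z y
  at-y      : z ≢ x → z ≡ y → SwapView x y z x
  elsewhere : z ≢ x → z ≢ y → SwapView x y z z

swap-view : ∀ {n} (x y z : Fin n) → SwapView x y z (swap x y z)
swap-view x y z with z ≟ x
... | yes z≡x = at-x z≡x
... | no z≢x with z ≟ y
...   | yes z≡y = at-y z≢x z≡y
...   | no z≢y = elsewhere z≢x z≢y

module _ {n : ℕ} where

  swap-x : (x y : Fin n) → swap x y x ≡ y
  swap-x x y with swap x y x | swap-view x y x
  ... | _ | at-x _ = refl
  ... | _ | at-y x≢x _ = ⊥-elim (x≢x refl)
  ... | _ | elsewhere x≢x _ = ⊥-elim (x≢x refl)

  swap-y : (x y : Fin n) → swap x y y ≡ x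
  swap-y x y with swap x y y | swap-view x y y
  ... | _ | at-x y≡x = y≡x
  ... | _ | at-y _ _ = refl
  ... | _ | elsewhere _ y≢y = ⊥-elim (y≢y refl)

  swap-elsewhere : {x y z : Fin n} → z ≢ x → z ≢ y → swap x y z ≡ z
  swap-elsewhere {x} {y} {z} z≢x z≢y with swap x y z | swap-view x y z
  ... | _ | at-x z≡x = ⊥-elim (z≢x z≡x)
  ... | _ | at-y _ z≡y = ⊥-elim (z≢y z≡y)
  ... | _ | elsewhere _ _ = refl

  swap-involutive : (x y z : Fin n) → swap x y (swap x y z) ≡ z
  swap-involutive x y z with swap x y z | swap-view x y z
  ... | _ | at-x refl = swap-y x y
  ... | _ | at-y _ refl = swap-x x y
  ... | _ | elsewhere z≢x z≢y = swap-elsewhere z≢x z≢y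

  swap-injective : (x y : Fin n) {a b : Fin n} → swap x y a ≡ swap x y b → a ≡ b
  swap-injective x y {a} {b} eq =
    trans (sym (swap-involutive x y a)) (trans (cong (swap x y) eq) (swap-involutive x y b))

  swap-self : (x z : Fin n) → swap x x z ≡ z
  swap-self x z with swap x x z | swap-view x x z
  ... | _ | at-x z≡x = sym z≡x
  ... | _ | at-y _ z≡x = sym z≡x
  ... | _ | elsewhere _ _ = refl

  swap-comm : (x y z : Fin n) → swap x y z ≡ swap y x z
  swap-comm x y z with swap x y z | swap-view x y z
  ... | _ | at-x refl = sym (swap-y y x)
  ... | _ | at-y _ refl = sym (swap-x y x)
  ... | _ | elsewhere z≢x z≢y = sym (swap-elsewhere z≢y z≢x)

  swap-determined : {x y u v : Fin n} → x < y → u < v →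
    (∀ z → swap x y z ≡ swap u v z) → x ≡ u × y ≡ v
  swap-determined {x} {y} {u} {v} x<y u<v same
    with swap u v x | swap-view u v x | trans (sym (swap-x x y)) (same x)
  ... | _ | at-x refl | y≡v = refl , y≡v
  ... | _ | at-y _ refl | refl = ⊥-elim (<-asym x<y u<v)
  ... | _ | elsewhere _ _ | y≡x = ⊥-elim (<⇒≢ x<y (sym y≡x))

-- Latin squares

record LatinLaws {n : ℕ} (L : Square n) : Set where
  field
    row-injective  : ∀ i {j j′} → L i j ≡ L i j′ → j ≡ j′
    col-injective  : ∀ j {i i′} → L i j ≡ L i′ j → i ≡ i′
    row-surjective : ∀ i s → ∃ λ j → L i j ≡ s
    col-surjective : ∀ j s → ∃ λ i → L i j ≡ s
open LatinLaws

isLatin⇒laws : ∀ {n} {L : Square n} → IsLatin L → LatinLaws L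
isLatin⇒laws {L = L} (rows-latin , cols-latin) = record
  { row-injective  = λ i {j} {j′} eq → let (_ , _ , unique) = rows-latin i (L i j) in
                       trans (unique j refl) (sym (unique j′ (sym eq)))
  ; col-injective  = λ j {i} {i′} eq → let (_ , _ , unique) = cols-latin j (L i j) in
                       trans (unique i refl) (sym (unique i′ (sym eq)))
  ; row-surjective = λ i s → let (j , Lij≡s , _) = rows-latin i s in j , Lij≡s
  ; col-surjective = λ j s → let (i , Lij≡s , _) = cols-latin j s in i , Lij≡s
  }

laws-resp-≈ : ∀ {n} {L L′ : Square n} → L ≈ L′ → LatinLaws L → LatinLaws L′
laws-resp-≈ {L = L} {L′} L≈L′ latin = record
  { row-injective  = λ i {j} {j′} eq →
      row-injective latin i (trans (L≈L′ i j) (trans eq (sym (L≈L′ i j′))))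
  ; col-injective  = λ j {i} {i′} eq →
      col-injective latin j (trans (L≈L′ i j) (trans eq (sym (L≈L′ i′ j))))
  ; row-surjective = λ i s → let (j , eq) = row-surjective latin i s in j , trans (sym (L≈L′ i j)) eq
  ; col-surjective = λ j s → let (i , eq) = col-surjective latin j s in i , trans (sym (L≈L′ i j)) eq
  }

laws-apply : ∀ {n} (e : Elementary n) {L : Square n} → LatinLaws L → LatinLaws (apply e L)
laws-apply (rowSwap x y) {L} latin = record
  { row-injective  = λ i → row-injective latin (swap x y i)
  ; col-injective  = λ j eq → swap-injective x y (col-injective latin j eq)
  ; row-surjective = λ i → row-surjective latin (swap x y i)
  ; col-surjective = λ j s → let (i , eq) = col-surjective latin j s in
      swap x y i , subst (λ r → L r j ≡ s) (sym (swap-involutive x y i)) eq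
  }
laws-apply (colSwap x y) {L} latin = record
  { row-injective  = λ i eq → swap-injective x y (row-injective latin i eq)
  ; col-injective  = λ j → col-injective latin (swap x y j)
  ; row-surjective = λ i s → let (j , eq) = row-surjective latin i s in
      swap x y j , subst (λ c → L i c ≡ s) (sym (swap-involutive x y j)) eq
  ; col-surjective = λ j → col-surjective latin (swap x y j)
  }
laws-apply (symSwap x y) {L} latin = record
  { row-injective  = λ i eq → row-injective latin i (swap-injective x y eq)
  ; col-injective  = λ j eq → col-injective latin j (swap-injective x y eq)
  ; row-surjective = λ i s → let (j , eq) = row-surjective latin i (swap x y s) in
      j , trans (cong (swap x y) eq) (swap-involutive x y s)
  ; col-surjective = λ j s → let (i , eq) = col-surjective latin j (swap x y s) in
      i , trans (cong (swap x y) eq) (swap-involutive x y s)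
  }

vertex-latin : ∀ {n} {T L : Square n} → LatinLaws T → Vertex T L → LatinLaws L
vertex-latin latin (here T≈L) = laws-resp-≈ T≈L latin
vertex-latin latin (step v (e , eL≈L′)) = laws-resp-≈ eL≈L′ (laws-apply e (vertex-latin latin v))

avoid-two : ∀ {A : Set} → DecidableEquality A → {a b c : A} →
  a ≢ b → a ≢ c → b ≢ c → (u v : A) → ∃ λ w → w ≢ u × w ≢ v
avoid-two _≟ᴬ_ {a} {b} {c} a≢b a≢c b≢c u v with a ≟ᴬ u | a ≟ᴬ v | b ≟ᴬ u | b ≟ᴬ v
... | no a≢u | no a≢v | _ | _ = a , a≢u , a≢v
... | _ | _ | no b≢u | no b≢v = b , b≢u , b≢v
... | yes refl | _ | yes refl | _ = ⊥-elim (a≢b refl)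
... | _ | yes refl | _ | yes refl = ⊥-elim (a≢b refl)
... | yes refl | _ | _ | yes refl = c , (λ c≡a → a≢c (sym c≡a)) , (λ c≡b → b≢c (sym c≡b))
... | _ | yes refl | yes refl | _ = c , (λ c≡b → b≢c (sym c≡b)) , (λ c≡a → a≢c (sym c≡a))

third : ∀ {n} → 3 ≤ n → (u v : Fin n) → ∃ λ w → w ≢ u × w ≢ v
third (s≤s (s≤s (s≤s _))) =
  avoid-two _≟_ {zero} {suc zero} {suc (suc zero)} (λ ()) (λ ()) (λ ())

-- Proper transformations

data Kind : Set where
  rows cols symbols : Kind

transformation : ∀ {n} → Kind → Fin n × Fin n → Elementary n
transformation rows (x , y) = rowSwap x y
transformation cols (x , y) = colSwap x y
transformation symbols (x , y) = symSwap x y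

kind : ∀ {n} → Elementary n → Kind
kind (rowSwap _ _) = rows
kind (colSwap _ _) = cols
kind (symSwap _ _) = symbols

ends : ∀ {n} → Elementary n → Fin n × Fin n
ends (rowSwap x y) = x , y
ends (colSwap x y) = x , y
ends (symSwap x y) = x , y

transformation-kind-ends : ∀ {n} (e : Elementary n) → transformation (kind e) (ends e) ≡ e
transformation-kind-ends (rowSwap _ _) = refl
transformation-kind-ends (colSwap _ _) = refl
transformation-kind-ends (symSwap _ _) = refl

kind-ends-transformation : ∀ {n} k (p : Fin n × Fin n) →
  (kind (transformation k p) , ends (transformation k p)) ≡ (k , p)
kind-ends-transformation rows _ = refl
kind-ends-transformation cols _ = refl
kind-ends-transformation symbols _ = refl

transformation-injective : ∀ {n} {k k′ : Kind} {p p′ : Fin n × Fin n} →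
  transformation k p ≡ transformation k′ p′ → k ≡ k′ × p ≡ p′
transformation-injective {k = k} {k′} {p} {p′} eq
  with trans (sym (kind-ends-transformation k p))
             (trans (cong (λ e → kind e , ends e) eq) (kind-ends-transformation k′ p′))
... | refl = refl , refl

Ordered : ∀ {n} → Fin n × Fin n → Set
Ordered (x , y) = x < y

Proper : ∀ {n} → Elementary n → Set
Proper e = Ordered (ends e)

transformation-proper : ∀ {n} k {p : Fin n × Fin n} → Ordered p → Proper (transformation k p)
transformation-proper rows x<y = x<y
transformation-proper cols x<y = x<y
transformation-proper symbols x<y = x<y

flip : ∀ {n} → Elementary n → Elementary n
flip e = transformation (kind e) (proj₂ (ends e) , proj₁ (ends e))

flip-apply : ∀ {n} (e : Elementary n) (L : Square n) → apply (flip e) L ≈ apply e L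
flip-apply (rowSwap x y) L i j = cong (λ r → L r j) (swap-comm y x i)
flip-apply (colSwap x y) L i j = cong (L i) (swap-comm y x j)
flip-apply (symSwap x y) L i j = swap-comm y x (L i j)

degenerate-apply : ∀ {n} (e : Elementary n) (L : Square n) →
  proj₁ (ends e) ≡ proj₂ (ends e) → apply e L ≈ L
degenerate-apply (rowSwap x _) L refl i j = cong (λ r → L r j) (swap-self x i)
degenerate-apply (colSwap x _) L refl i j = cong (L i) (swap-self x j)
degenerate-apply (symSwap x _) L refl i j = swap-self x (L i j)

normalise : ∀ {n} (e : Elementary n) (L : Square n) → ¬ (apply e L ≈ L) →
  ∃ λ e′ → Proper e′ × apply e′ L ≈ apply e L
normalise e L moves with <-cmp (proj₁ (ends e)) (proj₂ (ends e))
... | tri< x<y _ _ = e , x<y , λ _ _ → refl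
... | tri≈ _ x≡y _ = ⊥-elim (moves (degenerate-apply e L x≡y))
... | tri> _ _ y<x = flip e , transformation-proper (kind e) y<x , flip-apply e L

module _ {n : ℕ} {L : Square n} (latin : LatinLaws L) where

  proper-moves : (e : Elementary n) → Proper e → ¬ (L ≈ apply e L)
  proper-moves (rowSwap x y) x<y L≈ =
    <⇒≢ x<y (col-injective latin x (trans (L≈ x x) (cong (λ r → L r x) (swap-x x y))))
  proper-moves (colSwap x y) x<y L≈ =
    <⇒≢ x<y (row-injective latin x (trans (L≈ x x) (cong (L x) (swap-x x y))))
  proper-moves (symSwap x y) x<y L≈ =
    let (j , Lxj≡x) = row-surjective latin x x in
    <⇒≢ x<y (trans (sym Lxj≡x) (trans (L≈ x j) (trans (cong (swap x y) Lxj≡x) (swap-x x y))))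

  module _ (three : 3 ≤ n) where

    -- A row swap differs from every column swap: compare row x in a column
    -- fixed by the column swap.
    row≉col : ∀ {x y u v} → x < y → ¬ (apply (rowSwap x y) L ≈ apply (colSwap u v) L)
    row≉col {x} {y} {u} {v} x<y same =
      let (j , j≢u , j≢v) = third three u v in
      <⇒≢ x<y (sym (col-injective latin j
        (trans (cong (λ r → L r j) (sym (swap-x x y)))
               (trans (same x j) (cong (L x) (swap-elsewhere j≢u j≢v))))))

    -- A row swap differs from every symbol swap: compare row x at a symbol
    -- fixed by the symbol swap.
    row≉sym : ∀ {x y u v} → x < y → ¬ (apply (rowSwap x y) L ≈ apply (symSwap u v) L)
    row≉sym {x} {y} {u} {v} x<y same =
      let (s , s≢u , s≢v) = third three u v in
      let (j , Lxj≡s) = row-surjective latin x s in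
      <⇒≢ x<y (sym (col-injective latin j
        (trans (cong (λ r → L r j) (sym (swap-x x y)))
               (trans (same x j)
                      (trans (cong (swap u v) Lxj≡s)
                             (trans (swap-elsewhere s≢u s≢v) (sym Lxj≡s)))))))

    col≉sym : ∀ {x y u v} → x < y → ¬ (apply (colSwap x y) L ≈ apply (symSwap u v) L)
    col≉sym {x} {y} {u} {v} x<y same =
      let (s , s≢u , s≢v) = third three u v in
      let (i , Lix≡s) = col-surjective latin x s in
      <⇒≢ x<y (sym (row-injective latin i
        (trans (cong (L i) (sym (swap-x x y)))
               (trans (same i x)
                      (trans (cong (swap u v) Lix≡s)
                             (trans (swap-elsewhere s≢u s≢v) (sym Lix≡s)))))))

    proper-injective : (e e′ : Elementary n) → Proper e → Proper e′ →
      apply e L ≈ apply e′ L → e ≡ e′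
    proper-injective (rowSwap x y) (rowSwap u v) x<y u<v same =
      let (x≡u , y≡v) = swap-determined x<y u<v (λ i → col-injective latin i (same i i)) in
      cong₂ rowSwap x≡u y≡v
    proper-injective (colSwap x y) (colSwap u v) x<y u<v same =
      let (x≡u , y≡v) = swap-determined x<y u<v (λ j → row-injective latin j (same j j)) in
      cong₂ colSwap x≡u y≡v
    proper-injective (symSwap x y) (symSwap u v) x<y u<v same =
      let (x≡u , y≡v) = swap-determined x<y u<v (λ s →
            let (j , Lsj≡s) = row-surjective latin s s in
            subst (λ t → swap x y t ≡ swap u v t) Lsj≡s (same s j)) in
      cong₂ symSwap x≡u y≡v
    proper-injective (rowSwap _ _) (colSwap _ _) x<y _ same = ⊥-elim (row≉col x<y same)
    proper-injective (colSwap _ _) (rowSwap _ _) _ u<v same = ⊥-elim (row≉col u<v (λ i j → sym (same i j)))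
    proper-injective (rowSwap _ _) (symSwap _ _) x<y _ same = ⊥-elim (row≉sym x<y same)
    proper-injective (symSwap _ _) (rowSwap _ _) _ u<v same = ⊥-elim (row≉sym u<v (λ i j → sym (same i j)))
    proper-injective (colSwap _ _) (symSwap _ _) x<y _ same = ⊥-elim (col≉sym x<y same)
    proper-injective (symSwap _ _) (colSwap _ _) _ u<v same = ⊥-elim (col≉sym u<v (λ i j → sym (same i j)))

-- Enumerating the proper transformations

shift : ∀ {n} → Fin n × Fin n → Fin (suc n) × Fin (suc n)
shift (x , y) = suc x , suc y

from-zero : ∀ n → List (Fin (suc n) × Fin (suc n))
from-zero n = map (λ y → zero , suc y) (allFin n)

pairs : (n : ℕ) → List (Fin n × Fin n)
pairs zero = []
pairs (suc n) = from-zero n ++ map shift (pairs n)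

pairs-length : ∀ n → length (pairs n) ≡ n C 2
pairs-length zero = refl
pairs-length (suc n) = begin
  length (from-zero n ++ map shift (pairs n))           ≡⟨ length-++ (from-zero n) ⟩
  length (from-zero n) + length (map shift (pairs n))   ≡⟨ cong₂ _+_ from-zero-length shifted-length ⟩
  n C 1 + n C 2                                         ≡⟨ nCk+nC[k+1]≡[n+1]C[k+1] n 1 ⟩
  suc n C 2                                             ∎
  where
    open ≡-Reasoning
    from-zero-length : length (from-zero n) ≡ n C 1
    from-zero-length = trans (length-map _ (allFin n)) (trans (length-tabulate _) (sym (nC1≡n n)))
    shifted-length : length (map shift (pairs n)) ≡ n C 2
    shifted-length = trans (length-map shift (pairs n)) (pairs-length n)

pairs-unique : ∀ n → Unique (pairs n)
pairs-unique zero = []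
pairs-unique (suc n) =
  Unique.++⁺ (Unique.map⁺ (λ eq → suc-injective (cong proj₂ eq)) (Unique.allFin⁺ n))
             (Unique.map⁺ shift-injective (pairs-unique n))
             starts-differ
  where
    shift-injective : ∀ {p q : Fin n × Fin n} → shift p ≡ shift q → p ≡ q
    shift-injective {_ , _} {_ , _} refl = refl
    starts-differ : Disjoint (from-zero n) (map shift (pairs n))
    starts-differ (p∈zero , p∈shifted) with ∈-map⁻ _ p∈zero | ∈-map⁻ shift p∈shifted
    ... | _ , _ , refl | (_ , _) , _ , ()

pairs-ordered : ∀ n → All Ordered (pairs n)
pairs-ordered zero = []
pairs-ordered (suc n) =
  All.++⁺ (All.map⁺ (All.tabulate (λ _ → s≤s z≤n)))
          (All.map⁺ (All.map (λ {p} → shift-ordered p) (pairs-ordered n)))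
  where
    shift-ordered : (p : Fin n × Fin n) → Ordered p → Ordered (shift p)
    shift-ordered _ x<y = s≤s x<y

pairs-complete : ∀ {n} {x y : Fin n} → x < y → (x , y) ∈ pairs n
pairs-complete {suc n} {zero} {suc y} _ = ∈-++⁺ˡ (∈-map⁺ _ (∈-allFin y))
pairs-complete {suc n} {suc x} {suc y} (s≤s x<y) =
  ∈-++⁺ʳ (from-zero n) (∈-map⁺ shift (pairs-complete x<y))

kinds : List Kind
kinds = rows ∷ cols ∷ symbols ∷ []

kinds-unique : Unique kinds
kinds-unique = ((λ ()) ∷ (λ ()) ∷ []) ∷ ((λ ()) ∷ []) ∷ [] ∷ []

kinds-complete : ∀ k → k ∈ kinds
kinds-complete rows = here refl
kinds-complete cols = there (here refl)
kinds-complete symbols = there (there (here refl))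

length-cartesianProductWith : ∀ {A B C : Set} (f : A → B → C) (xs : List A) (ys : List B) →
  length (cartesianProductWith f xs ys) ≡ length xs * length ys
length-cartesianProductWith f [] ys = refl
length-cartesianProductWith f (x ∷ xs) ys = begin
  length (map (f x) ys ++ cartesianProductWith f xs ys)           ≡⟨ length-++ (map (f x) ys) ⟩
  length (map (f x) ys) + length (cartesianProductWith f xs ys)   ≡⟨ cong₂ _+_ (length-map (f x) ys)
                                                                      (length-cartesianProductWith f xs ys) ⟩
  length ys + length xs * length ys                               ∎
  where open ≡-Reasoning

properTransformations : (n : ℕ) → List (Elementary n)
properTransformations n = cartesianProductWith transformation kinds (pairs n)

properTransformations-length : ∀ n → length (properTransformations n) ≡ 3 * (n C 2)
properTransformations-length n =
  trans (length-cartesianProductWith transformation kinds (pairs n)) (cong (3 *_) (pairs-length n))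

properTransformations-unique : ∀ n → Unique (properTransformations n)
properTransformations-unique n =
  Unique.cartesianProductWith⁺ transformation transformation-injective kinds-unique (pairs-unique n)

properTransformations-proper : ∀ n → All Proper (properTransformations n)
properTransformations-proper n =
  All.cartesianProductWith⁺ (setoid Kind) (setoid (Fin n × Fin n)) transformation kinds (pairs n)
    (λ {k} _ p∈ → transformation-proper k (All.lookup (pairs-ordered n) p∈))

properTransformations-complete : ∀ {n} (e : Elementary n) → Proper e → e ∈ properTransformations n
properTransformations-complete e proper =
  Any.cartesianProductWith⁺ transformation
    (λ { refl refl → sym (transformation-kind-ends e) })
    (kinds-complete (kind e)) (pairs-complete proper)

-- The degree of a Latin square

map-injectiveOn : ∀ {A B : Set} {P : A → Set} (_∼_ : B → B → Set) (f : A → B) →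
  (∀ {a b} → P a → P b → f a ∼ f b → a ≡ b) →
  {xs : List A} → All P xs → Unique xs → AllPairs (λ s t → ¬ (s ∼ t)) (map f xs)
map-injectiveOn _∼_ f injective [] [] = []
map-injectiveOn _∼_ f injective (px ∷ pxs) (x∉xs ∷ unique) =
  All.map⁺ (All.zipWith (λ (py , x≢y) fx∼fy → x≢y (injective px py fx∼fy)) (pxs , x∉xs))
  ∷ map-injectiveOn _∼_ f injective pxs unique

latin-degree : ∀ {n} → 3 ≤ n → {L : Square n} → LatinLaws L → HasDegree L (3 * (n C 2))
latin-degree {n} three {L} latin = neighbours , count , distinct , adjacent , complete
  where
    image : Elementary n → Square n
    image e = apply e L

    neighbours : List (Square n)
    neighbours = map image (properTransformations n)

    count : length neighbours ≡ 3 * (n C 2)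
    count = trans (length-map image (properTransformations n)) (properTransformations-length n)

    distinct : AllPairs (λ A B → ¬ (A ≈ B)) neighbours
    distinct = map-injectiveOn _≈_ image (proper-injective latin three _ _)
                 (properTransformations-proper n) (properTransformations-unique n)

    adjacent : All (Adjacent L) neighbours
    adjacent = All.map⁺ (All.map (λ {e} proper → proper-moves latin e proper , e , λ _ _ → refl)
                                 (properTransformations-proper n))

    complete : ∀ L′ → Adjacent L L′ → Any (λ A → A ≈ L′) neighbours
    complete L′ (L≉L′ , e , eL≈L′) =
      let (e′ , proper , e′L≈eL) = normalise e L (λ eL≈L → L≉L′ (λ i j → trans (sym (eL≈L i j)) (eL≈L′ i j))) in
      Any.map⁺ (Any.map (λ { refl i j → trans (e′L≈eL i j) (eL≈L′ i j) })
                        (properTransformations-complete e′ proper))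

corollary4p4 : (n : ℕ) → 3 ≤ n → (T : Square n) → IsLatin T →
    IsotopyGraphRegular T (3 * (n C 2))
corollary4p4 n three T latin L vertex =
  latin-degree three (vertex-latin (isLatin⇒laws latin) vertex)
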